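{- Let $G=(X\cup Y,E)$ be a bipartite chain graph that is not complete bipartite, with chain ordering $\sigma_X=(x_1,\dots,x_{n_1})$, $\sigma_Y=(y_1,\dots,y_{n_2})$, and let $t$ be the maximum integer such that $G$ contains $K_{t,t}$ as an induced subgraph. Suppose $x_ty_{t+1}\in E$, $x_{t+1}y_t\notin E$ and $x_{t+1}y_{t-1}\in E$ (i.e., $G$ is a Type-II(b) BCG). If there exist vertices $z_1,\dots,z_{t-2}$ in $\{x_{t+2},x_{t+3},\dots,x_{n_1},y_{t+2},y_{t+3},\dots,y_{n_2}\}$ such that $t-j-1\ge |N(z_j)|\ge t-j-2$ for all $1\le j\le t-2$, then $TTr(G)=Tr(G)=t+1$.
   Context: All graphs are finite and simple; $N(v)$ is the set of neighbours of $v$. For disjoint vertex sets $A,B$, $A$ dominates $B$ if every vertex of $B$ has a neighbour in $A$. A transitive partition of order $k$ of $G=(V,E)$ is a partition $\{V_1,\dots,V_k\}$ of $V$ into nonempty sets with $V_i$ dominating $V_j$ for all $1\le i<j\le k$; the transitivity $Tr(G)$ is the maximum such $k$. A tournament transitive partition additionally requires that $V_j$ does not dominate $V_i$ for all $i<j$; the tournament transitivity $TTr(G)$ is the maximum order of such a partition. A bipartite graph $G=(X\cup Y,E)$ is a bipartite chain graph if there are orderings (chain orderings) $\sigma_X=(x_1,\dots,x_{n_1})$ of $X$ and $\sigma_Y=(y_1,\dots,y_{n_2})$ of $Y$ with $N(x_{n_1})\subseteq\cdots\subseteq N(x_1)$ and $N(y_{n_2})\subseteq\cdots\subseteq N(y_1)$.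 -}

module Defs where

open import Data.Nat using (ℕ; zero; suc; _+_; _∸_; _≤_; _<_)
open import Data.Fin using (Fin; toℕ)
open import Data.Bool using (Bool; true; false; T)
open import Data.Sum using (_⊎_; inj₁; inj₂)
open import Data.Product using (Σ; ∃; _×_; _,_)
open import Data.List using (List; []; _∷_; _++_; map; allFin)
open import Relation.Binary.PropositionalEquality using (_≡_)
open import Relation.Nullary using (¬_)
open import Function.Definitions using (Injective)

Dominates : {V : Set} → (V → V → Set) → (V → Set) → (V → Set) → Set
Dominates {V} Adj A B = ∀ (v : V) → B v → Σ V λ u → A u × Adj u v

Class : {V : Set} {k : ℕ} → (V → Fin k) → Fin k → V → Set
Class c i v = c v ≡ i

-- A partition {V_1,…,V_k} of V into nonempty sets, encoded as a surjective
-- map c : V → Fin k (V_i = c⁻¹(i)).  It is transitive if V_i dominates V_j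
-- for all i < j.
IsTransitivePartition : {V : Set} → (V → V → Set) → (k : ℕ) → (V → Fin k) → Set
IsTransitivePartition {V} Adj k c =
  (∀ (i : Fin k) → Σ V λ v → c v ≡ i) ×
  (∀ (i j : Fin k) → toℕ i < toℕ j → Dominates Adj (Class c i) (Class c j))

IsTournamentTransitivePartition : {V : Set} → (V → V → Set) → (k : ℕ) → (V → Fin k) → Set
IsTournamentTransitivePartition Adj k c =
  IsTransitivePartition Adj k c ×
  (∀ i j → toℕ i < toℕ j → ¬ Dominates Adj (Class c j) (Class c i))

HasTransitivePartition : {V : Set} → (V → V → Set) → ℕ → Set
HasTransitivePartition {V} Adj k = Σ (V → Fin k) (IsTransitivePartition Adj k)

HasTournamentTransitivePartition : {V : Set} → (V → V → Set) → ℕ → Set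
HasTournamentTransitivePartition {V} Adj k =
  Σ (V → Fin k) (IsTournamentTransitivePartition Adj k)

TrIs : {V : Set} → (V → V → Set) → ℕ → Set
TrIs Adj m = HasTransitivePartition Adj m × (∀ k → HasTransitivePartition Adj k → k ≤ m)

TTrIs : {V : Set} → (V → V → Set) → ℕ → Set
TTrIs Adj m =
  HasTournamentTransitivePartition Adj m ×
  (∀ k → HasTournamentTransitivePartition Adj k → k ≤ m)

HasInducedKss : {V : Set} → (V → V → Set) → ℕ → Set
HasInducedKss {V} Adj s =
  Σ (Fin s → V) λ f → Σ (Fin s → V) λ g →
    Injective _≡_ _≡_ f × Injective _≡_ _≡_ g ×
    (∀ a b → ¬ (f a ≡ g b)) ×
    (∀ a b → Adj (f a) (g b)) ×
    (∀ a b → ¬ Adj (f a) (f b)) ×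
    (∀ a b → ¬ Adj (g a) (g b))

MaxInducedKttIs : {V : Set} → (V → V → Set) → ℕ → Set
MaxInducedKttIs Adj t = HasInducedKss Adj t × (∀ s → HasInducedKss Adj s → s ≤ t)

-- Bipartite graphs G = (X ∪ Y, E) with X = {x_1..x_{n1}}, Y = {y_1..y_{n2}}.
-- x_i is represented by inj₁ (i-1), y_j by inj₂ (j-1); adjacency between X
-- and Y is given by a Boolean matrix adj.

Vert : ℕ → ℕ → Set
Vert n₁ n₂ = Fin n₁ ⊎ Fin n₂

adjB : {n₁ n₂ : ℕ} → (Fin n₁ → Fin n₂ → Bool) → Vert n₁ n₂ → Vert n₁ n₂ → Bool
adjB adj (inj₁ a) (inj₁ b) = false
adjB adj (inj₁ a) (inj₂ b) = adj a b
adjB adj (inj₂ a) (inj₁ b) = adj b a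
adjB adj (inj₂ a) (inj₂ b) = false

BAdj : {n₁ n₂ : ℕ} → (Fin n₁ → Fin n₂ → Bool) → Vert n₁ n₂ → Vert n₁ n₂ → Set
BAdj adj u v = T (adjB adj u v)

allVerts : (n₁ n₂ : ℕ) → List (Vert n₁ n₂)
allVerts n₁ n₂ = map inj₁ (allFin n₁) ++ map inj₂ (allFin n₂)

countTrue : {A : Set} → (A → Bool) → List A → ℕ
countTrue p [] = 0
countTrue p (x ∷ xs) with p x
... | true  = suc (countTrue p xs)
... | false = countTrue p xs

degree : {n₁ n₂ : ℕ} → (Fin n₁ → Fin n₂ → Bool) → Vert n₁ n₂ → ℕ
degree {n₁} {n₂} adj v = countTrue (adjB adj v) (allVerts n₁ n₂)

IsChainOrdering : {n₁ n₂ : ℕ} → (Fin n₁ → Fin n₂ → Bool) → Set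
IsChainOrdering {n₁} {n₂} adj =
  (∀ (a a' : Fin n₁) → toℕ a ≤ toℕ a' → ∀ b → adj a' b ≡ true → adj a b ≡ true) ×
  (∀ (b b' : Fin n₂) → toℕ b ≤ toℕ b' → ∀ a → adj a b' ≡ true → adj a b ≡ true)

IsCompleteBipartite : {n₁ n₂ : ℕ} → (Fin n₁ → Fin n₂ → Bool) → Set
IsCompleteBipartite adj = ∀ a b → adj a b ≡ true

-- x_i y_j ∈ E (1-based indices; the vertices exist)
EdgeXY : {n₁ n₂ : ℕ} → (Fin n₁ → Fin n₂ → Bool) → ℕ → ℕ → Set
EdgeXY {n₁} {n₂} adj i j =
  Σ (Fin n₁) λ a → Σ (Fin n₂) λ b → suc (toℕ a) ≡ i × suc (toℕ b) ≡ j × adj a b ≡ true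

NonEdgeXY : {n₁ n₂ : ℕ} → (Fin n₁ → Fin n₂ → Bool) → ℕ → ℕ → Set
NonEdgeXY {n₁} {n₂} adj i j =
  Σ (Fin n₁) λ a → Σ (Fin n₂) λ b → suc (toℕ a) ≡ i × suc (toℕ b) ≡ j × adj a b ≡ false

InTail : {n₁ n₂ : ℕ} → ℕ → Vert n₁ n₂ → Set
InTail t (inj₁ a) = t + 2 ≤ suc (toℕ a)
InTail t (inj₂ b) = t + 2 ≤ suc (toℕ b)

{-# OPTIONS --safe #-}
-- The three Type-II(b) adjacencies and the chain orderings make x_1..x_t complete to y_1..y_{t+1}
-- and x_{t+1} complete to y_1..y_{t-1}, and leave no edge between {x_{t+1},…} and {y_t,…}:
-- every edge meets the t low vertices x_1..x_t or the t - 1 low vertices y_1..y_{t-1}.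
--
-- Upper bound.  Let V_1..V_k be transitive with k ≥ t + 2.  A high x in V_j has a neighbour in
-- every V_i with i < j, and all of these are low y's; symmetrically for high y's.  The two top
-- classes contain adjacent x and y, and counting shows that both are low and that some V_m below
-- the top two contains no low x.  The neighbour of y in V_m is then a high x, so every class below
-- V_m contains a low y; and if a class V_i below the top two contains no low y, the neighbour of x
-- there is a high y, so every class below V_i contains a low x and i = m.  Thus the k - 2 ≥ t
-- classes other than V_m and the class of x all contain one of the t - 1 low y's.
--
-- Lower bound.  Take V_i = {x_i, y_i} for i ≤ t - 1, V_t = {x_{t+1}, y_t}, V_{t+1} = {x_t}, and put
-- y_{t+1} into V_{t-1}, z_j into V_{t-1-j} and every other vertex into V_1.  By the chain ordering
-- the neighbours of z_j are the first |N(z_j)| vertices of the other side, so the degree bounds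
-- make z_j dominated by every V_i below its class and adjacent to no later class.  Every class
-- contains an x, so none is dominated by V_{t+1} = {x_t}, and y_{t+1} ∈ V_{t-1} has no neighbour
-- in V_t because x_{t+1} y_{t+1} ∉ E.
module Submission where

open import Defs
open import Data.Nat using (ℕ; zero; suc; pred; _+_; _∸_; _≤_; _<_; z≤n; s≤s; _≤?_; _<?_; _≟_)
open import Data.Nat.Properties
open import Data.Fin using (Fin; toℕ; fromℕ; fromℕ<; inject₁; opposite; punchIn; punchOut)
  renaming (zero to fzero; suc to fsuc)
open import Data.Fin.Properties
  using (toℕ-injective; toℕ-fromℕ; toℕ-fromℕ<; toℕ-inject₁; toℕ<n; fromℕ<-injective; injective⇒≤;
         punchIn-injective; punchInᵢ≢i; punchIn-punchOut; any?; opposite-prop; opposite-involutive)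
  renaming (_≟_ to _≟ᶠ_)
open import Data.Bool using (Bool; true; false; T)
open import Data.Bool.Properties using (T-≡; not-¬; ¬-not)
open import Data.Product using (Σ; _×_; _,_; proj₁; proj₂)
open import Data.Sum using (_⊎_; inj₁; inj₂)
import Data.Sum as Sum
open import Data.Sum.Properties using (≡-dec)
open import Data.List using (List; []; _∷_; _++_; map; allFin; tabulate)
open import Data.Empty using (⊥; ⊥-elim)
open import Function using (_∘_; id; Equivalence)
open import Function.Definitions using (Injective)
open import Relation.Binary.PropositionalEquality
open import Relation.Nullary using (¬_; Dec; yes; no)
open import Relation.Nullary.Decidable using (_×-dec_; ¬?)
open import Relation.Binary.Definitions using (tri<; tri≈; tri>)

≡true⇒T : ∀ {b} → b ≡ true → T b
≡true⇒T = Equivalence.from T-≡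

T⇒≡true : ∀ {b} → T b → b ≡ true
T⇒≡true = Equivalence.to T-≡

-- Neighbourhoods in a chain graph

countTrue-++ : {A : Set} (p : A → Bool) (xs ys : List A) →
  countTrue p (xs ++ ys) ≡ countTrue p xs + countTrue p ys
countTrue-++ p []       ys = refl
countTrue-++ p (x ∷ xs) ys with p x
... | true  = cong suc (countTrue-++ p xs ys)
... | false = countTrue-++ p xs ys

countTrue-map : {A B : Set} (p : B → Bool) (f : A → B) (xs : List A) →
  countTrue p (map f xs) ≡ countTrue (p ∘ f) xs
countTrue-map p f []       = refl
countTrue-map p f (x ∷ xs) with p (f x)
... | true  = cong suc (countTrue-map p f xs)
... | false = countTrue-map p f xs

countTrue-false : {A : Set} (xs : List A) → countTrue (λ _ → false) xs ≡ 0
countTrue-false []       = refl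
countTrue-false (x ∷ xs) = countTrue-false xs

countTrue-tabulate-≤ : ∀ {A : Set} {n} (p : A → Bool) (g : Fin n → A) m →
  (∀ i → p (g i) ≡ true → toℕ i < m) → countTrue p (tabulate g) ≤ m
countTrue-tabulate-≤ {n = zero}  p g m       below = z≤n
countTrue-tabulate-≤ {n = suc n} p g m       below with p (g fzero) in eq
countTrue-tabulate-≤ {n = suc n} p g zero    below | true = ⊥-elim (n≮0 (below fzero eq))
countTrue-tabulate-≤ {n = suc n} p g (suc m) below | true =
  s≤s (countTrue-tabulate-≤ p (g ∘ fsuc) m (λ i gi → ≤-pred (below (fsuc i) gi)))
countTrue-tabulate-≤ {n = suc n} p g m       below | false =
  countTrue-tabulate-≤ p (g ∘ fsuc) m (λ i gi → <-trans (n<1+n _) (below (fsuc i) gi))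

countTrue-tabulate-≥ : ∀ {A : Set} {n} (p : A → Bool) (g : Fin n → A) m → m ≤ n →
  (∀ i → toℕ i < m → p (g i) ≡ true) → m ≤ countTrue p (tabulate g)
countTrue-tabulate-≥ p g zero    m≤n       true-below = z≤n
countTrue-tabulate-≥ p g (suc m) (s≤s m≤n) true-below with p (g fzero) | true-below fzero (s≤s z≤n)
... | true | _ = s≤s (countTrue-tabulate-≥ p (g ∘ fsuc) m m≤n (λ i i<m → true-below (fsuc i) (s≤s i<m)))

DownwardClosed : {n : ℕ} → (Fin n → Bool) → Set
DownwardClosed f = ∀ i j → toℕ i ≤ toℕ j → f j ≡ true → f i ≡ true

module _ {n : ℕ} {f : Fin n → Bool} (closed : DownwardClosed f) where

  true⇒<countTrue : ∀ j → f j ≡ true → toℕ j < countTrue f (allFin n)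
  true⇒<countTrue j fj = countTrue-tabulate-≥ f id (suc (toℕ j)) (toℕ<n j)
    (λ i i≤j → closed i j (≤-pred i≤j) fj)

  <countTrue⇒true : ∀ j → toℕ j < countTrue f (allFin n) → f j ≡ true
  <countTrue⇒true j j<count with f j in fj
  ... | true  = refl
  ... | false = ⊥-elim (<⇒≱ j<count (countTrue-tabulate-≤ f id (toℕ j) true⇒below))
    where
      true⇒below : ∀ i → f i ≡ true → toℕ i < toℕ j
      true⇒below i fi with toℕ i <? toℕ j
      ... | yes i<j = i<j
      ... | no  i≮j with trans (sym (closed j i (≮⇒≥ i≮j) fi)) fj
      ...   | ()

module _ {n₁ n₂ : ℕ} (adj : Fin n₁ → Fin n₂ → Bool) where

  degree-inj₁ : ∀ a → degree adj (inj₁ a) ≡ countTrue (adj a) (allFin n₂)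
  degree-inj₁ a = begin
    countTrue (adjB adj (inj₁ a)) (map inj₁ (allFin n₁) ++ map inj₂ (allFin n₂))
      ≡⟨ countTrue-++ _ (map inj₁ (allFin n₁)) _ ⟩
    countTrue (adjB adj (inj₁ a)) (map inj₁ (allFin n₁)) + countTrue (adjB adj (inj₁ a)) (map inj₂ (allFin n₂))
      ≡⟨ cong₂ _+_ (trans (countTrue-map _ inj₁ (allFin n₁)) (countTrue-false (allFin n₁))) (countTrue-map _ inj₂ (allFin n₂)) ⟩
    countTrue (adj a) (allFin n₂) ∎
    where open ≡-Reasoning

  degree-inj₂ : ∀ b → degree adj (inj₂ b) ≡ countTrue (λ a → adj a b) (allFin n₁)
  degree-inj₂ b = begin
    countTrue (adjB adj (inj₂ b)) (map inj₁ (allFin n₁) ++ map inj₂ (allFin n₂))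
      ≡⟨ countTrue-++ _ (map inj₁ (allFin n₁)) _ ⟩
    countTrue (adjB adj (inj₂ b)) (map inj₁ (allFin n₁)) + countTrue (adjB adj (inj₂ b)) (map inj₂ (allFin n₂))
      ≡⟨ cong₂ _+_ (countTrue-map _ inj₁ (allFin n₁)) (trans (countTrue-map _ inj₂ (allFin n₂)) (countTrue-false (allFin n₂))) ⟩
    countTrue (λ a → adj a b) (allFin n₁) + 0
      ≡⟨ +-identityʳ _ ⟩
    countTrue (λ a → adj a b) (allFin n₁) ∎
    where open ≡-Reasoning

index : {n₁ n₂ : ℕ} → Vert n₁ n₂ → ℕ
index (inj₁ a) = toℕ a
index (inj₂ b) = toℕ b

module _ {n₁ n₂ : ℕ} {adj : Fin n₁ → Fin n₂ → Bool} (chain : IsChainOrdering adj) where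

  adj-downward : ∀ {a a' b b'} → adj a b ≡ true → toℕ a' ≤ toℕ a → toℕ b' ≤ toℕ b → adj a' b' ≡ true
  adj-downward {a} {a'} {b} {b'} ab a'≤a b'≤b = proj₁ chain a' a a'≤a b' (proj₂ chain b' b b'≤b a ab)

  row-closed : ∀ a → DownwardClosed (adj a)
  row-closed a i j i≤j = proj₂ chain i j i≤j a

  column-closed : ∀ b → DownwardClosed (λ a → adj a b)
  column-closed b i j i≤j = proj₁ chain i j i≤j b

  <degree⇒adj₁ : ∀ a b → toℕ b < degree adj (inj₁ a) → adj a b ≡ true
  <degree⇒adj₁ a b b<deg = <countTrue⇒true (row-closed a) b
    (subst (toℕ b <_) (degree-inj₁ adj a) b<deg)

  <degree⇒adj₂ : ∀ a b → toℕ a < degree adj (inj₂ b) → adj a b ≡ true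
  <degree⇒adj₂ a b a<deg = <countTrue⇒true (column-closed b) a
    (subst (toℕ a <_) (degree-inj₂ adj b) a<deg)

  index<degree : ∀ u v → BAdj adj u v → index u < degree adj v
  index<degree (inj₂ b) (inj₁ a) ab = subst (toℕ b <_) (sym (degree-inj₁ adj a))
    (true⇒<countTrue (row-closed a) b (T⇒≡true ab))
  index<degree (inj₁ a) (inj₂ b) ab = subst (toℕ a <_) (sym (degree-inj₂ adj b))
    (true⇒<countTrue (column-closed b) a (T⇒≡true ab))

-- Transitive partitions given by levels

module _ {V : Set} (Adj : V → V → Set) where

  tournament⇒transitive : ∀ {k} → HasTournamentTransitivePartition Adj k → HasTransitivePartition Adj k
  tournament⇒transitive (c , transitive , _) = c , transitive

  TTrIs×TrIs : ∀ {k} → HasTournamentTransitivePartition Adj k →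
    (∀ m → HasTransitivePartition Adj m → m ≤ k) → TTrIs Adj k × TrIs Adj k
  TTrIs×TrIs partition bounded =
    (partition , λ m → bounded m ∘ tournament⇒transitive) ,
    (tournament⇒transitive partition , bounded)

  module _ {k : ℕ} (level : V → ℕ) (level<k : ∀ v → level v < k) where

    private
      c : V → Fin k
      c v = fromℕ< (level<k v)

      c≡⇒level≡ : ∀ {v i} → c v ≡ i → level v ≡ toℕ i
      c≡⇒level≡ {v} refl = sym (toℕ-fromℕ< (level<k v))

      level≡⇒c≡ : ∀ {v i} → level v ≡ toℕ i → c v ≡ i
      level≡⇒c≡ {v} eq = toℕ-injective (trans (toℕ-fromℕ< (level<k v)) eq)

    tournament-from-levels :
      (∀ i → i < k → Σ V λ v → level v ≡ i) →
      (∀ v i → i < level v → Σ V λ u → level u ≡ i × Adj u v) →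
      (∀ i j → i < j → j < k → Σ V λ v → level v ≡ i × (∀ u → level u ≡ j → ¬ Adj u v)) →
      HasTournamentTransitivePartition Adj k
    tournament-from-levels inhabited dominated undominated = c , (nonempty , dominates) , ¬dominates
      where
        nonempty : ∀ i → Σ V λ v → c v ≡ i
        nonempty i with inhabited (toℕ i) (toℕ<n i)
        ... | v , v∈i = v , level≡⇒c≡ v∈i

        dominates : ∀ i j → toℕ i < toℕ j → Dominates Adj (Class c i) (Class c j)
        dominates i j i<j v v∈j with dominated v (toℕ i) (subst (toℕ i <_) (sym (c≡⇒level≡ v∈j)) i<j)
        ... | u , u∈i , uv = u , level≡⇒c≡ u∈i , uv

        ¬dominates : ∀ i j → toℕ i < toℕ j → ¬ Dominates Adj (Class c j) (Class c i)
        ¬dominates i j i<j dominating with undominated (toℕ i) (toℕ j) i<j (toℕ<n j)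
        ... | v , v∈i , lonely with dominating v (level≡⇒c≡ v∈i)
        ...   | u , u∈j , uv = lonely u (c≡⇒level≡ u∈j) uv

-- The upper bound: every edge meets x_1..x_p or y_1..y_q with q < p

module _ {N k : ℕ} (g : Fin N → Fin k) where

  HasMemberBelow : ℕ → Fin k → Set
  HasMemberBelow n i = Σ (Fin N) λ a → toℕ a < n × g a ≡ i

  hasMemberBelow? : ∀ n i → Dec (HasMemberBelow n i)
  hasMemberBelow? n i = any? (λ a → (toℕ a <? n) ×-dec (g a ≟ᶠ i))

  members-below⇒≤ : ∀ {m n} (f : Fin m → Fin k) → Injective _≡_ _≡_ f →
    (∀ j → HasMemberBelow n (f j)) → m ≤ n
  members-below⇒≤ {m} {n} f f-injective member = injective⇒≤ {f = h} h-injective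
    where
      h : Fin m → Fin n
      h j = fromℕ< (proj₁ (proj₂ (member j)))

      h-injective : Injective _≡_ _≡_ h
      h-injective {j} {j'} hj≡hj' with member j | member j'
      ... | a , a<n , ga≡fj | a' , a'<n , ga'≡fj' =
        f-injective (trans (sym ga≡fj) (trans (cong g same-member) ga'≡fj'))
        where
          same-member : a ≡ a'
          same-member = toℕ-injective (fromℕ<-injective (toℕ a) (toℕ a') a<n a'<n hj≡hj')

members-but-one⇒≤ : ∀ {N k n} (g : Fin N → Fin (suc k)) (e : Fin (suc k)) →
  (∀ i → i ≢ e → HasMemberBelow g n i) → k ≤ n
members-but-one⇒≤ g e member =
  members-below⇒≤ g (punchIn e) (punchIn-injective e _ _) (λ j → member (punchIn e j) (punchInᵢ≢i e j))

members-but-two⇒≤ : ∀ {N k n} (g : Fin N → Fin (suc (suc k))) {e₁ e₂ : Fin (suc (suc k))} → e₁ ≢ e₂ →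
  (∀ i → i ≢ e₁ → i ≢ e₂ → HasMemberBelow g n i) → k ≤ n
members-but-two⇒≤ {k = k} g {e₁} {e₂} e₁≢e₂ member =
  members-below⇒≤ g f (λ {j} {j'} eq → punchIn-injective e₂' j j' (punchIn-injective e₁ _ _ eq))
    (λ j → member (f j) (punchInᵢ≢i e₁ _) (f≢e₂ j))
  where
    e₂' : Fin (suc k)
    e₂' = punchOut e₁≢e₂

    f : Fin k → Fin (suc (suc k))
    f j = punchIn e₁ (punchIn e₂' j)

    f≢e₂ : ∀ j → f j ≢ e₂
    f≢e₂ j eq = punchInᵢ≢i e₂' j (punchIn-injective e₁ _ _ (trans eq (sym (punchIn-punchOut e₁≢e₂))))

penultimate last : ∀ {k} → Fin (suc (suc k))
penultimate {k} = inject₁ (fromℕ k)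
last {k} = fromℕ (suc k)

k≤penultimate : ∀ {k} → k ≤ toℕ (penultimate {k})
k≤penultimate {k} = ≤-reflexive (sym (trans (toℕ-inject₁ (fromℕ k)) (toℕ-fromℕ k)))

penultimate<last : ∀ {k} → toℕ (penultimate {k}) < toℕ (last {k})
penultimate<last {k} = subst (toℕ (penultimate {k}) <_) (sym (toℕ-fromℕ (suc k))) (s≤s (≤-reflexive
  (trans (toℕ-inject₁ (fromℕ k)) (toℕ-fromℕ k))))

k≤last : ∀ {k} → k ≤ toℕ (last {k})
k≤last = <⇒≤ (≤-<-trans k≤penultimate penultimate<last)

top-two : ∀ {k} (i : Fin (suc (suc k))) → k ≤ toℕ i → i ≡ penultimate ⊎ i ≡ last
top-two {zero}  fzero        _         = inj₁ refl
top-two {zero}  (fsuc fzero) _         = inj₂ refl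
top-two {suc k} (fsuc i)     (s≤s k≤i) = Sum.map (cong fsuc) (cong fsuc) (top-two i k≤i)

module TransitivityBound {n₁ n₂ : ℕ} (adj : Fin n₁ → Fin n₂ → Bool) (p q : ℕ) (q<p : q < p)
  (covered : ∀ a b → adj a b ≡ true → toℕ a < p ⊎ toℕ b < q) where

  module _ {k : ℕ} (c : Vert n₁ n₂ → Fin (suc (suc k)))
    (transitive : IsTransitivePartition (BAdj adj) (suc (suc k)) c) (p≤k : p ≤ k) where

    LowX LowY : Fin (suc (suc k)) → Set
    LowX = HasMemberBelow (c ∘ inj₁) p
    LowY = HasMemberBelow (c ∘ inj₂) q

    neighbour-of-x : ∀ a i → toℕ i < toℕ (c (inj₁ a)) → Σ (Fin n₂) λ b → c (inj₂ b) ≡ i × adj a b ≡ true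
    neighbour-of-x a i i< with proj₂ transitive i (c (inj₁ a)) i< (inj₁ a) refl
    ... | inj₂ b , b∈i , ba = b , b∈i , T⇒≡true ba

    neighbour-of-y : ∀ b i → toℕ i < toℕ (c (inj₂ b)) → Σ (Fin n₁) λ a → c (inj₁ a) ≡ i × adj a b ≡ true
    neighbour-of-y b i i< with proj₂ transitive i (c (inj₂ b)) i< (inj₂ b) refl
    ... | inj₁ a , a∈i , ab = a , a∈i , T⇒≡true ab

    below-high-x : ∀ a i → p ≤ toℕ a → toℕ i < toℕ (c (inj₁ a)) → LowY i
    below-high-x a i high i< with neighbour-of-x a i i<
    ... | b , b∈i , ab with covered a b ab
    ...   | inj₁ a<p = ⊥-elim (<⇒≱ a<p high)
    ...   | inj₂ b<q = b , b<q , b∈i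

    below-high-y : ∀ b i → q ≤ toℕ b → toℕ i < toℕ (c (inj₂ b)) → LowX i
    below-high-y b i high i< with neighbour-of-y b i i<
    ... | a , a∈i , ab with covered a b ab
    ...   | inj₁ a<p = a , a<p , a∈i
    ...   | inj₂ b<q = ⊥-elim (<⇒≱ b<q high)

    record TopEdge : Set where
      field
        x        : Fin n₁
        y        : Fin n₂
        adjacent : adj x y ≡ true
        x-top    : k ≤ toℕ (c (inj₁ x))
        y-top    : k ≤ toℕ (c (inj₂ y))
        top      : ∀ i → k ≤ toℕ i → i ≡ c (inj₁ x) ⊎ i ≡ c (inj₂ y)

    top-edge : TopEdge
    top-edge with proj₁ transitive last
    ... | v , v∈last with proj₂ transitive penultimate last penultimate<last v v∈last
    ...   | u , u∈penultimate , uv = orient v u v∈last u∈penultimate uv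
      where
        orient : ∀ v u → c v ≡ last → c u ≡ penultimate → BAdj adj u v → TopEdge
        orient (inj₁ a) (inj₂ b) a∈last b∈penultimate ba = record
          { x = a ; y = b ; adjacent = T⇒≡true ba
          ; x-top = subst (λ i → k ≤ toℕ i) (sym a∈last) k≤last
          ; y-top = subst (λ i → k ≤ toℕ i) (sym b∈penultimate) k≤penultimate
          ; top   = λ i k≤i → Sum.swap (Sum.map (λ e → trans e (sym b∈penultimate)) (λ e → trans e (sym a∈last))
                      (top-two i k≤i))
          }
        orient (inj₂ b) (inj₁ a) b∈last a∈penultimate ab = record
          { x = a ; y = b ; adjacent = T⇒≡true ab
          ; x-top = subst (λ i → k ≤ toℕ i) (sym a∈penultimate) k≤penultimate
          ; y-top = subst (λ i → k ≤ toℕ i) (sym b∈last) k≤last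
          ; top   = λ i k≤i → Sum.map (λ e → trans e (sym a∈penultimate)) (λ e → trans e (sym b∈last))
                      (top-two i k≤i)
          }

    module _ (edge : TopEdge) where
      open TopEdge edge

      below-or-top : ∀ i → toℕ i < k ⊎ (i ≡ c (inj₁ x) ⊎ i ≡ c (inj₂ y))
      below-or-top i with toℕ i <? k
      ... | yes i<k = inj₁ i<k
      ... | no  i≮k = inj₂ (top i (≮⇒≥ i≮k))

      x-low : toℕ x < p
      x-low = ≰⇒> x-not-high
        where
          x-not-high : ¬ p ≤ toℕ x
          x-not-high high = 1+n≰n (≤-trans (members-but-one⇒≤ (c ∘ inj₂) (c (inj₁ x)) lowY) (≤-trans (<⇒≤ q<p) p≤k))
            where
              lowY : ∀ i → i ≢ c (inj₁ x) → LowY i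
              lowY i i≢cx with below-or-top i
              ... | inj₁ i<k        = below-high-x x i high (<-≤-trans i<k x-top)
              ... | inj₂ (inj₁ i≡cx) = ⊥-elim (i≢cx i≡cx)
              ... | inj₂ (inj₂ i≡cy) with covered x y adjacent
              ...   | inj₁ x<p = ⊥-elim (<⇒≱ x<p high)
              ...   | inj₂ y<q = y , y<q , sym i≡cy

      y-low : toℕ y < q
      y-low = ≰⇒> y-not-high
        where
          y-not-high : ¬ q ≤ toℕ y
          y-not-high high = 1+n≰n (≤-trans (members-but-one⇒≤ (c ∘ inj₁) (c (inj₂ y)) lowX) p≤k)
            where
              lowX : ∀ i → i ≢ c (inj₂ y) → LowX i
              lowX i i≢cy with below-or-top i
              ... | inj₁ i<k        = below-high-y y i high (<-≤-trans i<k y-top)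
              ... | inj₂ (inj₁ i≡cx) = x , x-low , sym i≡cx
              ... | inj₂ (inj₂ i≡cy) = ⊥-elim (i≢cy i≡cy)

      gap : Σ (Fin (suc (suc k))) λ m → toℕ m < k × ¬ LowX m
      gap with any? (λ m → (toℕ m <? k) ×-dec ¬? (hasMemberBelow? (c ∘ inj₁) p m))
      ... | yes found = found
      ... | no  none  = ⊥-elim (1+n≰n (≤-trans (members-but-one⇒≤ (c ∘ inj₁) (c (inj₂ y)) lowX) p≤k))
        where
          lowX : ∀ i → i ≢ c (inj₂ y) → LowX i
          lowX i i≢cy with below-or-top i
          ... | inj₂ (inj₁ i≡cx) = x , x-low , sym i≡cx
          ... | inj₂ (inj₂ i≡cy) = ⊥-elim (i≢cy i≡cy)
          ... | inj₁ i<k with hasMemberBelow? (c ∘ inj₁) p i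
          ...   | yes low  = low
          ...   | no  ¬low = ⊥-elim (none (i , i<k , ¬low))

      module _ (m : Fin (suc (suc k))) (m<k : toℕ m < k) (¬lowX-m : ¬ LowX m) where

        below-gap : ∀ i → toℕ i < toℕ m → LowY i
        below-gap i i<m with neighbour-of-y y m (<-≤-trans m<k y-top)
        ... | a , a∈m , _ = below-high-x a i (≮⇒≥ λ a<p → ¬lowX-m (a , a<p , a∈m))
                              (subst (λ j → toℕ i < toℕ j) (sym a∈m) i<m)

        only-gap-lacks-lowY : ∀ i → toℕ i < k → i ≢ m → LowY i
        only-gap-lacks-lowY i i<k i≢m with hasMemberBelow? (c ∘ inj₂) q i
        ... | yes low  = low
        ... | no  ¬low with neighbour-of-x x i (<-≤-trans i<k x-top) | <-cmp (toℕ i) (toℕ m)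
        ...   | _ , _ , _ | tri< i<m _ _ = ⊥-elim (¬low (below-gap i i<m))
        ...   | _ , _ , _ | tri≈ _ i≡m _ = ⊥-elim (i≢m (toℕ-injective i≡m))
        ...   | b , b∈i , _ | tri> _ _ m<i = ⊥-elim (¬lowX-m (below-high-y b m
                  (≮⇒≥ λ b<q → ¬low (b , b<q , b∈i)) (subst (λ j → toℕ m < toℕ j) (sym b∈i) m<i)))

        lowY : ∀ i → i ≢ m → i ≢ c (inj₁ x) → LowY i
        lowY i i≢m i≢cx with below-or-top i
        ... | inj₁ i<k        = only-gap-lacks-lowY i i<k i≢m
        ... | inj₂ (inj₁ i≡cx) = ⊥-elim (i≢cx i≡cx)
        ... | inj₂ (inj₂ i≡cy) = y , y-low , sym i≡cy

        m≢cx : m ≢ c (inj₁ x)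
        m≢cx m≡cx = <⇒≱ m<k (subst (λ i → k ≤ toℕ i) (sym m≡cx) x-top)

        gap-impossible : ⊥
        gap-impossible = 1+n≰n (≤-trans (s≤s (members-but-two⇒≤ (c ∘ inj₂) m≢cx lowY)) (≤-trans q<p p≤k))

      top-edge-impossible : ⊥
      top-edge-impossible with gap
      ... | m , m<k , ¬lowX-m = gap-impossible m m<k ¬lowX-m

  transitivity≤ : ∀ m → HasTransitivePartition (BAdj adj) m → m ≤ suc p
  transitivity≤ m (c , transitive) = ≮⇒≥ (λ p+1<m → too-large m p+1<m c transitive)
    where
      too-large : ∀ m → suc p < m → (c : Vert n₁ n₂ → Fin m) → IsTransitivePartition (BAdj adj) m c → ⊥
      too-large (suc (suc k)) (s≤s (s≤s p≤k)) c transitive =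
        top-edge-impossible c transitive p≤k (top-edge c transitive p≤k)

-- Type-II(b) chain graphs

-- Indices are 0-based and t = s + 2; for instance toℕ a ≤ suc s says that a is one of x_1..x_t.
record TypeIIb {n₁ n₂ : ℕ} (adj : Fin n₁ → Fin n₂ → Bool) (s : ℕ) : Set where
  field
    x-count   : suc (suc (suc s)) ≤ n₁
    y-count   : suc (suc (suc s)) ≤ n₂
    complete₁ : ∀ a b → toℕ a ≤ suc s → toℕ b ≤ suc (suc s) → adj a b ≡ true
    complete₂ : ∀ a b → toℕ a ≤ suc (suc s) → toℕ b ≤ s → adj a b ≡ true
    separated : ∀ a b → suc (suc s) ≤ toℕ a → suc s ≤ toℕ b → adj a b ≡ false

  covered : ∀ a b → adj a b ≡ true → toℕ a < suc (suc s) ⊎ toℕ b < suc s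
  covered a b ab with toℕ a <? suc (suc s) | toℕ b <? suc s
  ... | yes a<  | _      = inj₁ a<
  ... | no  _   | yes b< = inj₂ b<
  ... | no  a≮  | no  b≮ = ⊥-elim (not-¬ ab (separated a b (≮⇒≥ a≮) (≮⇒≥ b≮)))

typeIIb : ∀ {n₁ n₂} {adj : Fin n₁ → Fin n₂ → Bool} s → IsChainOrdering adj →
  EdgeXY adj (suc (suc s)) (suc (suc s) + 1) →
  NonEdgeXY adj (suc (suc s) + 1) (suc (suc s)) →
  EdgeXY adj (suc (suc s) + 1) (suc s) →
  TypeIIb adj s
typeIIb s chain (a₁ , b₁ , a₁≡ , b₁≡ , a₁b₁) (a₂ , b₂ , a₂≡ , b₂≡ , a₂b₂) (a₃ , b₃ , a₃≡ , b₃≡ , a₃b₃) = record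
  { x-count   = subst (_< _) toℕ-a₂ (toℕ<n a₂)
  ; y-count   = subst (_< _) toℕ-b₁ (toℕ<n b₁)
  ; complete₁ = λ a b a≤ b≤ → adj-downward chain a₁b₁ (subst (_ ≤_) (sym toℕ-a₁) a≤) (subst (_ ≤_) (sym toℕ-b₁) b≤)
  ; complete₂ = λ a b a≤ b≤ → adj-downward chain a₃b₃ (subst (_ ≤_) (sym toℕ-a₃) a≤) (subst (_ ≤_) (sym toℕ-b₃) b≤)
  ; separated = λ a b a≥ b≥ → ¬-not λ ab →
      not-¬ (adj-downward chain ab (subst (_≤ _) (sym toℕ-a₂) a≥) (subst (_≤ _) (sym toℕ-b₂) b≥)) a₂b₂
  }
  where
    t+1 : suc (suc s) + 1 ≡ suc (suc (suc s))
    t+1 = +-comm (suc (suc s)) 1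

    toℕ-a₁ : toℕ a₁ ≡ suc s
    toℕ-a₁ = suc-injective a₁≡

    toℕ-b₁ : toℕ b₁ ≡ suc (suc s)
    toℕ-b₁ = suc-injective (trans b₁≡ t+1)

    toℕ-a₂ : toℕ a₂ ≡ suc (suc s)
    toℕ-a₂ = suc-injective (trans a₂≡ t+1)

    toℕ-a₃ : toℕ a₃ ≡ suc (suc s)
    toℕ-a₃ = suc-injective (trans a₃≡ t+1)

    toℕ-b₂ : toℕ b₂ ≡ suc s
    toℕ-b₂ = suc-injective b₂≡

    toℕ-b₃ : toℕ b₃ ≡ s
    toℕ-b₃ = suc-injective b₃≡

data Slot (s n : ℕ) : Set where
  core  : n ≤ s → Slot s n
  edge₁ : n ≡ suc s → Slot s n
  edge₂ : n ≡ suc (suc s) → Slot s n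
  tail  : suc (suc (suc s)) ≤ n → Slot s n

slot : ∀ s n → Slot s n
slot s n with n ≤? s
... | yes n≤s = core n≤s
... | no  n≰s with n ≟ suc s
...   | yes n≡s+1 = edge₁ n≡s+1
...   | no  n≢s+1 with n ≟ suc (suc s)
...     | yes n≡s+2 = edge₂ n≡s+2
...     | no  n≢s+2 = tail (≤∧≢⇒< (≤∧≢⇒< (≰⇒> n≰s) (n≢s+1 ∘ sym)) (n≢s+2 ∘ sym))

slot-unique : ∀ {s n} (σ τ : Slot s n) → σ ≡ τ
slot-unique (core p)     (core q)     = cong core (≤-irrelevant p q)
slot-unique (edge₁ p)    (edge₁ q)    = cong edge₁ (≡-irrelevant p q)
slot-unique (edge₂ p)    (edge₂ q)    = cong edge₂ (≡-irrelevant p q)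
slot-unique (tail p)     (tail q)     = cong tail (≤-irrelevant p q)
slot-unique (core p)     (edge₁ refl) = ⊥-elim (1+n≰n p)
slot-unique (core p)     (edge₂ refl) = ⊥-elim (1+n≰n (≤-trans (n≤1+n _) p))
slot-unique (core p)     (tail q)     = ⊥-elim (<⇒≱ (s≤s (m≤n⇒m≤1+n (n≤1+n _))) (≤-trans q p))
slot-unique (edge₁ refl) (core q)     = ⊥-elim (1+n≰n q)
slot-unique (edge₁ refl) (edge₂ ())
slot-unique (edge₁ refl) (tail q)     = ⊥-elim (1+n≰n (≤-pred (m≤n⇒m≤1+n q)))
slot-unique (edge₂ refl) (core q)     = ⊥-elim (1+n≰n (≤-trans (n≤1+n _) q))
slot-unique (edge₂ refl) (edge₁ ())
slot-unique (edge₂ refl) (tail q)     = ⊥-elim (1+n≰n q)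
slot-unique (tail p)     (core q)     = ⊥-elim (<⇒≱ (s≤s (m≤n⇒m≤1+n (n≤1+n _))) (≤-trans p q))
slot-unique (tail p)     (edge₁ refl) = ⊥-elim (1+n≰n (≤-pred (m≤n⇒m≤1+n p)))
slot-unique (tail p)     (edge₂ refl) = ⊥-elim (1+n≰n p)

module TournamentConstruction {n₁ n₂ : ℕ} {adj : Fin n₁ → Fin n₂ → Bool} (chain : IsChainOrdering adj)
  {s : ℕ} (G : TypeIIb adj s)
  (w : Fin s → Vert n₁ n₂) (w-injective : Injective _≡_ _≡_ w)
  (w-tail : ∀ i → suc (suc (suc s)) ≤ index (w i))
  (w-degree : ∀ i → toℕ i ≤ degree adj (w i) × degree adj (w i) ≤ suc (toℕ i)) where

  open TypeIIb G

  isW? : ∀ v → Dec (Σ (Fin s) λ i → w i ≡ v)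
  isW? v = any? (λ i → ≡-dec _≟ᶠ_ _≟ᶠ_ (w i) v)

  tailLevel : Vert n₁ n₂ → ℕ
  tailLevel v with isW? v
  ... | yes (i , _) = toℕ i
  ... | no  _       = 0

  xLevelAt : (a : Fin n₁) → Slot s (toℕ a) → ℕ
  xLevelAt a (core _)  = toℕ a
  xLevelAt a (edge₁ _) = suc (suc s)
  xLevelAt a (edge₂ _) = suc s
  xLevelAt a (tail _)  = tailLevel (inj₁ a)

  yLevelAt : (b : Fin n₂) → Slot s (toℕ b) → ℕ
  yLevelAt b (core _)  = toℕ b
  yLevelAt b (edge₁ _) = suc s
  yLevelAt b (edge₂ _) = s
  yLevelAt b (tail _)  = tailLevel (inj₂ b)

  -- level v is the 0-based index of the class of v in the partition described at the top.
  level : Vert n₁ n₂ → ℕ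
  level (inj₁ a) = xLevelAt a (slot s (toℕ a))
  level (inj₂ b) = yLevelAt b (slot s (toℕ b))

  level-x : ∀ a (σ : Slot s (toℕ a)) → level (inj₁ a) ≡ xLevelAt a σ
  level-x a σ = cong (xLevelAt a) (slot-unique (slot s (toℕ a)) σ)

  level-y : ∀ b (σ : Slot s (toℕ b)) → level (inj₂ b) ≡ yLevelAt b σ
  level-y b σ = cong (yLevelAt b) (slot-unique (slot s (toℕ b)) σ)

  tailLevel-w : ∀ i → tailLevel (w i) ≡ toℕ i
  tailLevel-w i with isW? (w i)
  ... | yes (j , wj≡wi) = cong toℕ (w-injective wj≡wi)
  ... | no  ¬w          = ⊥-elim (¬w (i , refl))

  below-tailLevel : ∀ v i → i < tailLevel v → Σ (Fin s) λ j → w j ≡ v × i < toℕ j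
  below-tailLevel v i i< with isW? v
  ... | yes (j , wj≡v) = j , wj≡v , i<

  tailLevel≤ : ∀ v → tailLevel v ≤ s
  tailLevel≤ v with isW? v
  ... | yes (j , _) = <⇒≤ (toℕ<n j)
  ... | no  _       = z≤n

  level-core : ∀ u → index u ≤ s → level u ≡ index u
  level-core (inj₁ a) a≤s = level-x a (core a≤s)
  level-core (inj₂ b) b≤s = level-y b (core b≤s)

  level-tail : ∀ u → suc (suc (suc s)) ≤ index u → level u ≡ tailLevel u
  level-tail (inj₁ a) a-tail = level-x a (tail a-tail)
  level-tail (inj₂ b) b-tail = level-y b (tail b-tail)

  level-w : ∀ i → level (w i) ≡ toℕ i
  level-w i = trans (level-tail (w i) (w-tail i)) (tailLevel-w i)

  y-level≤ : ∀ b → level (inj₂ b) ≤ suc s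
  y-level≤ b with slot s (toℕ b)
  ... | core b≤s  = m≤n⇒m≤1+n b≤s
  ... | edge₁ _   = ≤-refl
  ... | edge₂ _   = n≤1+n s
  ... | tail _    = m≤n⇒m≤1+n (tailLevel≤ (inj₂ b))

  level≤ : ∀ v → level v ≤ suc (suc s)
  level≤ (inj₂ b) = m≤n⇒m≤1+n (y-level≤ b)
  level≤ (inj₁ a) with slot s (toℕ a)
  ... | core a≤s  = m≤n⇒m≤1+n (m≤n⇒m≤1+n a≤s)
  ... | edge₁ _   = ≤-refl
  ... | edge₂ _   = n≤1+n _
  ... | tail _    = m≤n⇒m≤1+n (m≤n⇒m≤1+n (tailLevel≤ (inj₁ a)))

  xAt : ∀ i → i ≤ suc (suc s) → Fin n₁
  xAt i i≤ = fromℕ< (≤-trans (s≤s i≤) x-count)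

  yAt : ∀ i → i ≤ suc (suc s) → Fin n₂
  yAt i i≤ = fromℕ< (≤-trans (s≤s i≤) y-count)

  toℕ-xAt : ∀ i i≤ → toℕ (xAt i i≤) ≡ i
  toℕ-xAt i i≤ = toℕ-fromℕ< (≤-trans (s≤s i≤) x-count)

  toℕ-yAt : ∀ i i≤ → toℕ (yAt i i≤) ≡ i
  toℕ-yAt i i≤ = toℕ-fromℕ< (≤-trans (s≤s i≤) y-count)

  HasNeighbourAt : ℕ → Vert n₁ n₂ → Set
  HasNeighbourAt i v = Σ (Vert n₁ n₂) λ u → level u ≡ i × BAdj adj u v

  NotDominatedBy : ℕ → ℕ → Set
  NotDominatedBy i j = Σ (Vert n₁ n₂) λ v → level v ≡ i × (∀ u → level u ≡ j → ¬ BAdj adj u v)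

  xCore : ∀ i → i ≤ s → Σ (Fin n₁) λ a → toℕ a ≡ i × level (inj₁ a) ≡ i
  xCore i i≤s = a , toℕ-a , trans (level-core (inj₁ a) (subst (_≤ s) (sym toℕ-a) i≤s)) toℕ-a
    where
      i≤ : i ≤ suc (suc s)
      i≤ = m≤n⇒m≤1+n (m≤n⇒m≤1+n i≤s)

      a : Fin n₁
      a = xAt i i≤

      toℕ-a : toℕ a ≡ i
      toℕ-a = toℕ-xAt i i≤

  yCore : ∀ i → i ≤ suc s → Σ (Fin n₂) λ b → toℕ b ≡ i × level (inj₂ b) ≡ i
  yCore i i≤s+1 = b , toℕ-b , level-b (m≤n⇒m<n∨m≡n i≤s+1)
    where
      i≤ : i ≤ suc (suc s)
      i≤ = m≤n⇒m≤1+n i≤s+1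

      b : Fin n₂
      b = yAt i i≤

      toℕ-b : toℕ b ≡ i
      toℕ-b = toℕ-yAt i i≤

      level-b : i < suc s ⊎ i ≡ suc s → level (inj₂ b) ≡ i
      level-b (inj₁ i<) = trans (level-core (inj₂ b) (subst (_≤ s) (sym toℕ-b) (≤-pred i<))) toℕ-b
      level-b (inj₂ i≡) = trans (level-y b (edge₁ (trans toℕ-b i≡))) (sym i≡)

  x-of-level : ∀ i → i ≤ suc (suc s) → Σ (Fin n₁) λ a → level (inj₁ a) ≡ i
  x-of-level i i≤ with slot s i
  ... | core i≤s   = proj₁ (xCore i i≤s) , proj₂ (proj₂ (xCore i i≤s))
  ... | edge₁ refl = xAt _ ≤-refl , level-x _ (edge₂ (toℕ-xAt _ ≤-refl))
  ... | edge₂ refl = xAt _ (n≤1+n _) , level-x _ (edge₁ (toℕ-xAt _ (n≤1+n _)))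
  ... | tail i≥    = ⊥-elim (1+n≰n (≤-trans i≥ i≤))

  y-neighbour : ∀ a i → toℕ a ≤ suc s → i ≤ suc s → HasNeighbourAt i (inj₁ a)
  y-neighbour a i a≤ i≤ with yCore i i≤
  ... | b , b≡i , b∈i = inj₂ b , b∈i ,
    ≡true⇒T (complete₁ a b a≤ (subst (_≤ suc (suc s)) (sym b≡i) (m≤n⇒m≤1+n i≤)))

  x-neighbour : ∀ b i → toℕ b ≤ suc (suc s) → i ≤ s → HasNeighbourAt i (inj₂ b)
  x-neighbour b i b≤ i≤s with xCore i i≤s
  ... | a , a≡i , a∈i = inj₁ a , a∈i ,
    ≡true⇒T (complete₁ a b (subst (_≤ suc s) (sym a≡i) (m≤n⇒m≤1+n i≤s)) b≤)

  w-dominated : ∀ j i → i < toℕ j → HasNeighbourAt i (w j)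
  w-dominated j i i<j with w j | proj₁ (w-degree j)
  ... | inj₁ a | j≤deg with yCore i (m≤n⇒m≤1+n (<⇒≤ (<-trans i<j (toℕ<n j))))
  ...   | b , b≡i , b∈i = inj₂ b , b∈i ,
    ≡true⇒T (<degree⇒adj₁ chain a b (subst (_< degree adj (inj₁ a)) (sym b≡i) (<-≤-trans i<j j≤deg)))
  w-dominated j i i<j | inj₂ b | j≤deg with xCore i (<⇒≤ (<-trans i<j (toℕ<n j)))
  ...   | a , a≡i , a∈i = inj₁ a , a∈i ,
    ≡true⇒T (<degree⇒adj₂ chain a b (subst (_< degree adj (inj₂ b)) (sym a≡i) (<-≤-trans i<j j≤deg)))

  tail-dominated : ∀ v i → i < tailLevel v → HasNeighbourAt i v
  tail-dominated v i i< with below-tailLevel v i i<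
  ... | j , refl , i<j = w-dominated j i i<j

  dominated : ∀ v i → i < level v → HasNeighbourAt i v
  dominated (inj₁ a) i i< with slot s (toℕ a)
  ... | core a≤s  = y-neighbour a i (m≤n⇒m≤1+n a≤s) (<⇒≤ (<-≤-trans i< (m≤n⇒m≤1+n a≤s)))
  ... | edge₁ a≡  = y-neighbour a i (≤-reflexive a≡) (≤-pred i<)
  ... | tail _    = tail-dominated (inj₁ a) i i<
  ... | edge₂ a≡ with yCore i (m≤n⇒m≤1+n (≤-pred i<))
  ...   | b , b≡i , b∈i = inj₂ b , b∈i ,
    ≡true⇒T (complete₂ a b (≤-reflexive a≡) (subst (_≤ s) (sym b≡i) (≤-pred i<)))
  dominated (inj₂ b) i i< with slot s (toℕ b)
  ... | core b≤s  = x-neighbour b i (m≤n⇒m≤1+n (m≤n⇒m≤1+n b≤s)) (<⇒≤ (<-≤-trans i< b≤s))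
  ... | edge₁ b≡  = x-neighbour b i (m≤n⇒m≤1+n (≤-reflexive b≡)) (≤-pred i<)
  ... | edge₂ b≡  = x-neighbour b i (≤-reflexive b≡) (<⇒≤ i<)
  ... | tail _    = tail-dominated (inj₂ b) i i<

  w-neighbour-level≤ : ∀ j u → BAdj adj u (w j) → level u ≤ toℕ j
  w-neighbour-level≤ j u uw = subst (_≤ toℕ j) (sym (level-core u (<⇒≤ (≤-<-trans u≤j (toℕ<n j))))) u≤j
    where
      u≤j : index u ≤ toℕ j
      u≤j = ≤-pred (≤-trans (index<degree chain u (w j) uw) (proj₂ (w-degree j)))

  top-undominated : ∀ i → i ≤ suc (suc s) → NotDominatedBy i (suc (suc s))
  top-undominated i i≤ with x-of-level i i≤
  ... | a , a∈i = inj₁ a , a∈i , no-y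
    where
      no-y : ∀ u → level u ≡ suc (suc s) → ¬ BAdj adj u (inj₁ a)
      no-y (inj₂ b) b∈top _ = 1+n≰n (subst (_≤ suc s) b∈top (y-level≤ b))

  penultimate-undominated : NotDominatedBy s (suc s)
  penultimate-undominated = inj₂ y , level-y y (edge₂ toℕ-y) , no-x
    where
      y : Fin n₂
      y = yAt (suc (suc s)) ≤-refl

      toℕ-y : toℕ y ≡ suc (suc s)
      toℕ-y = toℕ-yAt (suc (suc s)) ≤-refl

      y-high : suc s ≤ toℕ y
      y-high = ≤-trans (n≤1+n _) (≤-reflexive (sym toℕ-y))

      no-x : ∀ u → level u ≡ suc s → ¬ BAdj adj u (inj₂ y)
      no-x (inj₁ a) a∈ ay with slot s (toℕ a)
      ... | core a≤s  = 1+n≰n (subst (_≤ s) a∈ a≤s)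
      ... | edge₁ _   = 1+n≰n (≤-reflexive a∈)
      ... | edge₂ a≡  = subst T (separated a y (≤-reflexive (sym a≡)) y-high) ay
      ... | tail a≥   = subst T (separated a y (≤-trans (n≤1+n _) a≥) y-high) ay

  undominated : ∀ i j → i < j → j < suc (suc (suc s)) → NotDominatedBy i j
  undominated i j i<j j≤ with i <? s
  ... | yes i<s = w k , trans (level-w k) toℕ-k , no-neighbour
    where
      k : Fin s
      k = fromℕ< i<s

      toℕ-k : toℕ k ≡ i
      toℕ-k = toℕ-fromℕ< i<s

      no-neighbour : ∀ u → level u ≡ j → ¬ BAdj adj u (w k)
      no-neighbour u u∈j uw = <⇒≱ i<j (subst₂ _≤_ u∈j toℕ-k (w-neighbour-level≤ k u uw))
  ... | no i≮s with j ≟ suc (suc s)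
  ...   | yes refl = top-undominated i (<⇒≤ i<j)
  ...   | no  j≢   = subst₂ NotDominatedBy (sym i≡s) (sym j≡s+1) penultimate-undominated
    where
      j≤s+1 : j ≤ suc s
      j≤s+1 = ≤-pred (≤∧≢⇒< (≤-pred j≤) j≢)

      i≡s : i ≡ s
      i≡s = ≤-antisym (≤-pred (≤-trans i<j j≤s+1)) (≮⇒≥ i≮s)

      j≡s+1 : j ≡ suc s
      j≡s+1 = ≤-antisym j≤s+1 (≤-trans (s≤s (≮⇒≥ i≮s)) i<j)

  inhabited : ∀ i → i < suc (suc (suc s)) → Σ (Vert n₁ n₂) λ v → level v ≡ i
  inhabited i i< with x-of-level i (≤-pred i<)
  ... | a , a∈i = inj₁ a , a∈i

  partition : HasTournamentTransitivePartition (BAdj adj) (suc (suc (suc s)))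
  partition = tournament-from-levels (BAdj adj) level (s≤s ∘ level≤) inhabited dominated undominated

in-tail : ∀ {n₁ n₂} s (v : Vert n₁ n₂) → InTail (suc (suc s)) v → suc (suc (suc s)) ≤ index v
in-tail s (inj₁ a) = ≤-pred ∘ subst (_≤ suc (toℕ a)) (+-comm (suc (suc s)) 2)
in-tail s (inj₂ b) = ≤-pred ∘ subst (_≤ suc (toℕ b)) (+-comm (suc (suc s)) 2)

opposite-complement : ∀ {s} (i : Fin s) → s ∸ toℕ (opposite i) ≡ suc (toℕ i)
opposite-complement {s} i = trans (cong (s ∸_) (opposite-prop i)) (m∸[m∸n]≡n (toℕ<n i))

opposite-degree-upper : ∀ {s} (i : Fin s) → suc (suc s) ∸ (suc (toℕ (opposite i)) + 1) ≡ suc (toℕ i)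
opposite-degree-upper {s} i = trans (cong (suc (suc s) ∸_) (+-comm (suc (toℕ (opposite i))) 1)) (opposite-complement i)

opposite-degree-lower : ∀ {s} (i : Fin s) → suc (suc s) ∸ (suc (toℕ (opposite i)) + 2) ≡ toℕ i
opposite-degree-lower {s} i = begin
  suc (suc s) ∸ (suc (toℕ (opposite i)) + 2) ≡⟨ cong (suc (suc s) ∸_) (+-comm (suc (toℕ (opposite i))) 2) ⟩
  s ∸ suc (toℕ (opposite i))                 ≡⟨ pred[m∸n]≡m∸[1+n] s (toℕ (opposite i)) ⟨
  pred (s ∸ toℕ (opposite i))                ≡⟨ cong pred (opposite-complement i) ⟩
  toℕ i                                      ∎
  where open ≡-Reasoning

mainTheorem5 : (n₁ n₂ : ℕ) (adj : Fin n₁ → Fin n₂ → Bool) (t : ℕ) →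
    IsChainOrdering adj →
    ¬ IsCompleteBipartite adj →
    MaxInducedKttIs (BAdj adj) t →
    EdgeXY adj t (t + 1) →
    NonEdgeXY adj (t + 1) t →
    EdgeXY adj (t + 1) (t ∸ 1) →
    (Σ (Fin (t ∸ 2) → Vert n₁ n₂) λ z →
      Injective _≡_ _≡_ z ×
      (∀ k → InTail t (z k)) ×
      (∀ k → degree adj (z k) ≤ t ∸ (suc (toℕ k) + 1)
           × t ∸ (suc (toℕ k) + 2) ≤ degree adj (z k))) →
    TTrIs (BAdj adj) (t + 1) × TrIs (BAdj adj) (t + 1)
mainTheorem5 n₁ n₂ adj zero          _ _ _ (_ , _ , () , _) _ _ _
mainTheorem5 n₁ n₂ adj (suc zero)    _ _ _ _ _ (_ , _ , _ , () , _) _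
mainTheorem5 n₁ n₂ adj (suc (suc s)) chain _ _ e₁ ne e₂ (z , z-injective , z-tail , z-degree) =
  subst (λ k → TTrIs (BAdj adj) k × TrIs (BAdj adj) k) (+-comm 1 (suc (suc s)))
    (TTrIs×TrIs (BAdj adj) partition (transitivity≤ (suc (suc s)) (suc s) ≤-refl (TypeIIb.covered G)))
  where
    G : TypeIIb adj s
    G = typeIIb s chain e₁ ne e₂

    -- z_j, with j = toℕ k + 1, has level t - 2 - j = toℕ (opposite k).
    w : Fin s → Vert n₁ n₂
    w = z ∘ opposite

    w-injective : Injective _≡_ _≡_ w
    w-injective {i} {j} eq =
      trans (sym (opposite-involutive i)) (trans (cong opposite (z-injective eq)) (opposite-involutive j))

    w-degree : ∀ i → toℕ i ≤ degree adj (w i) × degree adj (w i) ≤ suc (toℕ i)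
    w-degree i = subst (_≤ degree adj (w i)) (opposite-degree-lower i) (proj₂ (z-degree (opposite i))) ,
                 subst (degree adj (w i) ≤_) (opposite-degree-upper i) (proj₁ (z-degree (opposite i)))

    open TournamentConstruction chain G w w-injective (λ i → in-tail s (w i) (z-tail (opposite i))) w-degree
      using (partition)
    open TransitivityBound adj using (transitivity≤)
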